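{- Let $\Phi$ be the root system of type $G_2$ with simple roots $\alpha_1$ (short) and $\alpha_2$ (long), $\theta_s=2\alpha_1+\alpha_2$, $\theta_\ell=3\alpha_1+2\alpha_2$. Then \[ Z_\Phi(\mathrm{\bf x};u)\,(1-u^2\mathrm{\bf x}^{2\theta_\ell})=\frac{\sum_{w\in\{1,\sigma_1\}}\Big(\frac{1}{(1-ux_2)(1-u\,\mathrm{\bf x}^{\theta_s})}\Big)\Big|w}{1-x_1^2}. \]
   Context: The $G_2$ inner product is normalized by $\langle\alpha_1,\alpha_1\rangle=2$, $\langle\alpha_2,\alpha_2\rangle=6$, $\langle\alpha_1,\alpha_2\rangle=-3$; positive roots are $\alpha_1,\alpha_2,\alpha_1+\alpha_2,2\alpha_1+\alpha_2,3\alpha_1+\alpha_2,3\alpha_1+2\alpha_2$, and $m_\alpha=2$ for all roots. $F=\mathbb{Q}(u)$; $F(Q)$ is the field of rational functions in $x_1,x_2$ with $\mathrm{\bf x}^{n_1\alpha_1+n_2\alpha_2}=x_1^{n_1}x_2^{n_2}$. For a multivariable $y=(y_1,y_2)$: $y^\lambda$ likewise, $wy=(y^{w^{ -1}\alpha_1},y^{w^{ -1}\alpha_2})$ for $w$ in the Weyl group $W$, $\varepsilon_jy=((-1)^{\langle\alpha_1,\alpha_j\rangle}y_1,(-1)^{\langle\alpha_2,\alpha_j\rangle}y_2)$; $f(y)$ is substitution; $f^\pm_j(\mathrm{\bf x})=\frac12(f(\mathrm{\bf x})\pm f(\varepsilon_j\mathrm{\bf x}))$. The right action of $W$ on $F(Q)$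 is given on simple reflections $\sigma_j$ by $f|\sigma_j=-x_j^2\big(\frac{1-u/x_j}{1-ux_j}f^+_j(\sigma_j\mathrm{\bf x})+x_j^{ -1}f^-_j(\sigma_j\mathrm{\bf x})\big)$, and $Z_\Phi(\mathrm{\bf x};u)=\big(\sum_{w\in W}1|w\big)/\prod_{\alpha\in\Phi^+}(1-\mathrm{\bf x}^{2\alpha})$. -}

module Defs where

open import Data.Bool using (Bool; true; false; not; if_then_else_; _∧_)
open import Data.Nat as ℕ using (ℕ; zero; suc)
open import Data.Integer as ℤ using (ℤ; +_; -[1+_]; ∣_∣; _≟_)
open import Data.Fin using (Fin; zero; suc)
open import Data.List using (List; []; _∷_; _++_; map; concatMap; foldl; foldr)
open import Data.Product using (_×_; _,_; proj₁; proj₂)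
open import Relation.Nullary using (¬_)
open import Relation.Nullary.Decidable using (⌊_⌋)
open import Relation.Binary.PropositionalEquality using (_≡_)

-- A monomial u^a x₁^e₁ x₂^e₂ is recorded by its exponent triple (a , e₁ , e₂).

Mon : Set
Mon = ℤ × ℤ × ℤ

Poly : Set
Poly = List (ℤ × Mon)

_==ℤ_ : ℤ → ℤ → Bool
a ==ℤ b = ⌊ a ≟ b ⌋

_==M_ : Mon → Mon → Bool
(a , b , c) ==M (a' , b' , c') = (a ==ℤ a') ∧ ((b ==ℤ b') ∧ (c ==ℤ c'))

coeff : Poly → Mon → ℤ
coeff []             m = + 0
coeff ((c , m') ∷ p) m = (if m' ==M m then c else + 0) ℤ.+ coeff p m

_≈P_ : Poly → Poly → Set
p ≈P q = ∀ m → coeff p m ≡ coeff q m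

NonZeroP : Poly → Set
NonZeroP p = ¬ (∀ m → coeff p m ≡ + 0)

mon : ℤ → ℤ → ℤ → ℤ → Poly
mon c a e₁ e₂ = (c , (a , e₁ , e₂)) ∷ []

0P 1P : Poly
0P = []
1P = mon (+ 1) (+ 0) (+ 0) (+ 0)

_+P_ : Poly → Poly → Poly
p +P q = p ++ q

-P_ : Poly → Poly
-P p = map (λ { (c , m) → (ℤ.- c , m) }) p

_*P_ : Poly → Poly → Poly
p *P q = concatMap (λ { (c , (a , b , e)) →
           map (λ { (c' , (a' , b' , e')) → (c ℤ.* c' , (a ℤ.+ a' , b ℤ.+ b' , e ℤ.+ e')) }) q }) p

-- Substitution x_i ↦ s_i · x^{β_i} (s_i = ±1, β_i ∈ ℤ² in the basis α₁, α₂),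
-- u fixed.  A substitution is given by, for each variable i, a flag
-- "sign is -1" and the exponent vector β_i.

Subst : Set
Subst = (Bool × ℤ × ℤ) × (Bool × ℤ × ℤ)

oddℕ : ℕ → Bool
oddℕ zero    = false
oddℕ (suc n) = not (oddℕ n)

signPow : Bool → ℤ → ℤ
signPow false e = + 1
signPow true  e = if oddℕ ∣ e ∣ then ℤ.- (+ 1) else + 1

substP : Subst → Poly → Poly
substP ((s₁ , b₁₁ , b₁₂) , (s₂ , b₂₁ , b₂₂)) =
  map (λ { (c , (a , e₁ , e₂)) →
    (c ℤ.* signPow s₁ e₁ ℤ.* signPow s₂ e₂ ,
     (a , e₁ ℤ.* b₁₁ ℤ.+ e₂ ℤ.* b₂₁ , e₁ ℤ.* b₁₂ ℤ.+ e₂ ℤ.* b₂₂)) })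

Frac : Set
Frac = Poly × Poly

num den : Frac → Poly
num = proj₁
den = proj₂

_≈F_ : Frac → Frac → Set
f ≈F g = (num f *P den g) ≈P (num g *P den f)

fromP : Poly → Frac
fromP p = (p , 1P)

1F : Frac
1F = fromP 1P

_+F_ : Frac → Frac → Frac
(n , d) +F (n' , d') = ((n *P d') +P (n' *P d) , d *P d')

-F_ : Frac → Frac
-F (n , d) = (-P n , d)

_*F_ : Frac → Frac → Frac
(n , d) *F (n' , d') = (n *P n' , d *P d')

_/F_ : Frac → Frac → Frac
(n , d) /F (n' , d') = (n *P d' , d *P n')

substF : Subst → Frac → Frac
substF σ (n , d) = (substP σ n , substP σ d)

-- The root datum of G₂ in the basis of simple roots α₁ (short), α₂ (long).

ip : Fin 2 → Fin 2 → ℤ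
ip zero       zero       = + 2
ip zero       (suc zero) = ℤ.- (+ 3)
ip (suc zero) zero       = ℤ.- (+ 3)
ip (suc zero) (suc zero) = + 6

-- σ_j α_i = α_i - (2⟨α_i,α_j⟩/⟨α_j,α_j⟩) α_j, as coordinate vectors in (α₁, α₂):
-- σ₁α₁ = -α₁, σ₁α₂ = 3α₁+α₂, σ₂α₁ = α₁+α₂, σ₂α₂ = -α₂.
reflRoot : Fin 2 → Fin 2 → ℤ × ℤ
reflRoot zero       zero       = (ℤ.- (+ 1) , + 0)
reflRoot zero       (suc zero) = (+ 3 , + 1)
reflRoot (suc zero) zero       = (+ 1 , + 1)
reflRoot (suc zero) (suc zero) = (+ 0 , ℤ.- (+ 1))

-- f ↦ f(σ_j x), where σ_j x = (x^{σ_j α₁}, x^{σ_j α₂})  (σ_j⁻¹ = σ_j)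
sigmaSub : Fin 2 → Subst
sigmaSub j = ((false , reflRoot j zero) , (false , reflRoot j (suc zero)))

-- f ↦ f(ε_j x), ε_j y = ((-1)^{⟨α₁,α_j⟩} y₁, (-1)^{⟨α₂,α_j⟩} y₂)
epsSub : Fin 2 → Subst
epsSub j = ((oddℕ ∣ ip zero j ∣ , + 1 , + 0) , (oddℕ ∣ ip (suc zero) j ∣ , + 0 , + 1))

xvar : Fin 2 → ℤ → Poly
xvar zero       c = mon c (+ 0) (+ 1) (+ 0)
xvar (suc zero) c = mon c (+ 0) (+ 0) (+ 1)

xpow : Fin 2 → ℤ → Poly
xpow zero       e = mon (+ 1) (+ 0) e (+ 0)
xpow (suc zero) e = mon (+ 1) (+ 0) (+ 0) e

uP : Poly
uP = mon (+ 1) (+ 1) (+ 0) (+ 0)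

halfF : Frac
halfF = (1P , mon (+ 2) (+ 0) (+ 0) (+ 0))

fPlusσ fMinusσ : Fin 2 → Frac → Frac
fPlusσ  j f = halfF *F (substF (sigmaSub j) f +F substF (sigmaSub j) (substF (epsSub j) f))
fMinusσ j f = halfF *F (substF (sigmaSub j) f +F (-F substF (sigmaSub j) (substF (epsSub j) f)))

_∣σ_ : Frac → Fin 2 → Frac
f ∣σ j =
  fromP (-P xpow j (+ 2)) *F
    ( ( (fromP (1P +P (-P (uP *P xpow j (ℤ.- (+ 1))))) /F fromP (1P +P (-P (uP *P xpow j (+ 1)))))
          *F fPlusσ j f)
      +F (fromP (xpow j (ℤ.- (+ 1))) *F fMinusσ j f) )

_∣_ : Frac → List (Fin 2) → Frac
f ∣ w = foldl _∣σ_ f w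

-- The Weyl group of G₂ (dihedral of order 12), each element given by a reduced word.
s₁ s₂ : Fin 2
s₁ = zero
s₂ = suc zero

WeylG2 : List (List (Fin 2))
WeylG2 =
  [] ∷
  (s₁ ∷ []) ∷ (s₂ ∷ []) ∷
  (s₁ ∷ s₂ ∷ []) ∷ (s₂ ∷ s₁ ∷ []) ∷
  (s₁ ∷ s₂ ∷ s₁ ∷ []) ∷ (s₂ ∷ s₁ ∷ s₂ ∷ []) ∷
  (s₁ ∷ s₂ ∷ s₁ ∷ s₂ ∷ []) ∷ (s₂ ∷ s₁ ∷ s₂ ∷ s₁ ∷ []) ∷
  (s₁ ∷ s₂ ∷ s₁ ∷ s₂ ∷ s₁ ∷ []) ∷ (s₂ ∷ s₁ ∷ s₂ ∷ s₁ ∷ s₂ ∷ []) ∷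
  (s₁ ∷ s₂ ∷ s₁ ∷ s₂ ∷ s₁ ∷ s₂ ∷ []) ∷
  []

sumF : List Frac → Frac
sumF = foldr _+F_ (fromP 0P)

xroot : ℤ → ℤ → Poly
xroot n₁ n₂ = mon (+ 1) (+ 0) n₁ n₂

posRootsG2 : List (ℤ × ℤ)
posRootsG2 = (+ 1 , + 0) ∷ (+ 0 , + 1) ∷ (+ 1 , + 1) ∷ (+ 2 , + 1) ∷ (+ 3 , + 1) ∷ (+ 3 , + 2) ∷ []

oneMinusX2 : ℤ × ℤ → Poly
oneMinusX2 (n₁ , n₂) = 1P +P (-P xroot (+ 2 ℤ.* n₁) (+ 2 ℤ.* n₂))

ZG2 : Frac
ZG2 = sumF (map (λ w → 1F ∣ w) WeylG2)
      /F fromP (foldr (λ α p → oneMinusX2 α *P p) 1P posRootsG2)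

θs θℓ : ℤ × ℤ
θs = (+ 2 , + 1)
θℓ = (+ 3 , + 2)

lhsG2 : Frac
lhsG2 = ZG2 *F fromP (1P +P (-P (mon (+ 1) (+ 2) (+ 2 ℤ.* proj₁ θℓ) (+ 2 ℤ.* proj₂ θℓ))))

gG2 : Frac
gG2 = 1F /F fromP ((1P +P (-P (uP *P xpow s₂ (+ 1))))
                    *P (1P +P (-P (uP *P xroot (proj₁ θs) (proj₂ θs)))))

rhsG2 : Frac
rhsG2 = sumF (map (λ w → gG2 ∣ w) ([] ∷ (s₁ ∷ []) ∷ []))
        /F fromP (1P +P (-P xpow s₁ (+ 2)))

{-# OPTIONS --safe #-}
module Submission where

-- Both sides are formal fractions that are never reduced, so their denominators grow
-- exponentially along the Weyl group action and cannot be compared by brute force. Each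
-- fraction is therefore shadowed by a cheap representative: a normalised numerator over a
-- list of factors 1 - c x^M (M ≠ 0) and c x^M (c ≠ 0), where a sum only multiplies in the
-- factors the two denominators do not share. Such factors are non-zero-divisors of
-- ℤ[u^±, x₁^±, x₂^±]: if p (1 - c x^M) = 0 then p_m = c p_{m-M} for all m, which forces p = 0
-- because the support of p is finite. Hence the formal denominators are non-zero, and the
-- cross-multiplied identity of the formal fractions follows from an identity between the
-- representatives, which is checked by normalising a single polynomial to zero.

open import Defs
open import Level using (0ℓ)
open import Data.Bool using (Bool; true; false; if_then_else_; _∧_; T)
open import Data.Unit using (tt)
open import Data.Nat as ℕ using (ℕ; zero; suc)
import Data.Nat.Properties as ℕₚ
open import Data.Integer as ℤ
  using (ℤ; +_; -[1+_]; ∣_∣; _+_; _*_; -_; _-_; _≤_; _<_; _⊓_; _⊖_; +≤+; -≤+; +<+)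
open import Data.Integer.Properties
open import Data.Integer.Tactic.RingSolver using (solve-∀)
open import Data.Fin using (Fin; zero; suc)
open import Data.List using (List; []; _∷_; _++_; map; foldl; foldr; null)
import Data.List.Properties as List
open import Data.Product using (_×_; _,_; proj₁; proj₂)
open import Data.Sum using (inj₁; inj₂)
open import Data.List.Relation.Unary.All as All using (All; []; _∷_)
import Data.List.Relation.Unary.All.Properties as Allₚ
open import Data.Empty using (⊥-elim)
open import Function using (_⇔_; mk⇔; Equivalence; case_of_; _∘_)
import Function.Properties.Equivalence as ⇔
open import Relation.Nullary using (Dec; yes; no; does; _×-dec_; ¬?)
open import Relation.Nullary.Decidable using (map′; does-⇔; dec-false; isYes≗does; toWitness)
open import Relation.Binary.Definitions using (DecidableEquality)
open import Relation.Unary using (Decidable)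
open import Relation.Binary.Structures using (IsEquivalence)
open import Algebra.Bundles using (CommutativeRing)
open import Data.Maybe using (nothing)
open import Tactic.RingSolver.Core.AlmostCommutativeRing using (fromCommutativeRing)
import Tactic.RingSolver.NonReflective
import Relation.Binary.Reasoning.Setoid
open import Relation.Binary.PropositionalEquality
  using (_≡_; _≢_; refl; sym; trans; cong; cong₂; subst; module ≡-Reasoning)

infixl 6 _+M_ _-M_

_+M_ _-M_ : Mon → Mon → Mon
(a , b , c) +M (a′ , b′ , c′) = (a + a′ , b + b′ , c + c′)
(a , b , c) -M (a′ , b′ , c′) = (a - a′ , b - b′ , c - c′)

0M : Mon
0M = (+ 0 , + 0 , + 0)

_≟M_ : DecidableEquality Mon
(a , b , c) ≟M (a′ , b′ , c′) =
  map′ (λ { (refl , refl , refl) → refl }) (λ { refl → refl , refl , refl })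
       (a ℤ.≟ a′ ×-dec b ℤ.≟ b′ ×-dec c ℤ.≟ c′)

==M-does : ∀ x y → x ==M y ≡ does (x ≟M y)
==M-does (a , b , c) (a′ , b′ , c′) =
  cong₂ _∧_ (isYes≗does (a ℤ.≟ a′)) (cong₂ _∧_ (isYes≗does (b ℤ.≟ b′)) (isYes≗does (c ℤ.≟ c′)))

==M-⇔ : ∀ {x y x′ y′} → x ≡ y ⇔ x′ ≡ y′ → x ==M y ≡ x′ ==M y′
==M-⇔ {x} {y} {x′} {y′} x≡y⇔x′≡y′ = begin
  x ==M y            ≡⟨ ==M-does x y ⟩
  does (x ≟M y)      ≡⟨ does-⇔ x≡y⇔x′≡y′ (x ≟M y) (x′ ≟M y′) ⟩
  does (x′ ≟M y′)    ≡⟨ ==M-does x′ y′ ⟨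
  x′ ==M y′          ∎
  where open ≡-Reasoning

==M-sound : ∀ x y → x ==M y ≡ true → x ≡ y
==M-sound x y eq = witness (x ≟M y) (trans (sym (==M-does x y)) eq)
  where
  witness : (x≟y : Dec (x ≡ y)) → does x≟y ≡ true → x ≡ y
  witness (yes x≡y) _ = x≡y

==M-false : ∀ x y → x ≢ y → x ==M y ≡ false
==M-false x y x≢y = trans (==M-does x y) (dec-false (x ≟M y) x≢y)

+M-comm : ∀ s t → s +M t ≡ t +M s
+M-comm (a , b , c) (a′ , b′ , c′) = cong₂ _,_ (+-comm a a′) (cong₂ _,_ (+-comm b b′) (+-comm c c′))

+M≡⇔≡-M : ∀ t s m → t +M s ≡ m ⇔ s ≡ m -M t
+M≡⇔≡-M (a , b , c) (a′ , b′ , c′) (m₁ , m₂ , m₃) = mk⇔ to from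
  where
  cancel₁ : ∀ x y → (x + y) - x ≡ y
  cancel₁ = solve-∀
  cancel₂ : ∀ x m → x + (m - x) ≡ m
  cancel₂ = solve-∀
  to : (a + a′ , b + b′ , c + c′) ≡ (m₁ , m₂ , m₃) → (a′ , b′ , c′) ≡ (m₁ - a , m₂ - b , m₃ - c)
  to refl = sym (cong₂ _,_ (cancel₁ a a′) (cong₂ _,_ (cancel₁ b b′) (cancel₁ c c′)))
  from : (a′ , b′ , c′) ≡ (m₁ - a , m₂ - b , m₃ - c) → (a + a′ , b + b′ , c + c′) ≡ (m₁ , m₂ , m₃)
  from refl = cong₂ _,_ (cancel₂ a m₁) (cong₂ _,_ (cancel₂ b m₂) (cancel₂ c m₃))

-M-0M : ∀ m → m -M 0M ≡ m
-M-0M (a , b , c) = cong₂ _,_ (+-identityʳ a) (cong₂ _,_ (+-identityʳ b) (+-identityʳ c))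

-M-swap : ∀ m s t → (m -M s) -M t ≡ (m -M t) -M s
-M-swap (a , b , c) (a′ , b′ , c′) (a″ , b″ , c″) =
  cong₂ _,_ (swap a a′ a″) (cong₂ _,_ (swap b b′ b″) (swap c c′ c″))
  where
  swap : ∀ x y z → (x - y) - z ≡ (x - z) - y
  swap = solve-∀

+M-M : ∀ m M → (m +M M) -M M ≡ m
+M-M m M = sym (Equivalence.to (+M≡⇔≡-M M m (m +M M)) (+M-comm M m))

pairing : Poly → (Mon → ℤ) → ℤ
pairing []            h = + 0
pairing ((c , t) ∷ p) h = c * h t + pairing p h

term : ℤ → Mon → Mon → ℤ
term c t m = if t ==M m then c else + 0

indicator : Mon → Mon → ℤ
indicator m t = term (+ 1) t m

if-then-0-* : ∀ b c d → (if b then c * d else + 0) ≡ c * (if b then d else + 0)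
if-then-0-* true  c d = refl
if-then-0-* false c d = sym (*-zeroʳ c)

coeff-pairing : ∀ p m → coeff p m ≡ pairing p (indicator m)
coeff-pairing []            m = refl
coeff-pairing ((c , t) ∷ p) m =
  cong₂ _+_ (trans (cong (λ d → if t ==M m then d else + 0) (sym (*-identityʳ c)))
                   (if-then-0-* (t ==M m) c (+ 1)))
            (coeff-pairing p m)

pairing-cong : ∀ p {f g : Mon → ℤ} → (∀ t → f t ≡ g t) → pairing p f ≡ pairing p g
pairing-cong []            f≗g = refl
pairing-cong ((c , t) ∷ p) f≗g = cong₂ _+_ (cong (c *_) (f≗g t)) (pairing-cong p f≗g)

pairing-+ : ∀ p (f g : Mon → ℤ) → pairing p (λ t → f t + g t) ≡ pairing p f + pairing p g
pairing-+ []            f g = refl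
pairing-+ ((c , t) ∷ p) f g rewrite pairing-+ p f g = lemma c (f t) (g t) (pairing p f) (pairing p g)
  where
  lemma : ∀ c x y A B → c * (x + y) + (A + B) ≡ (c * x + A) + (c * y + B)
  lemma = solve-∀

pairing-* : ∀ p a (f : Mon → ℤ) → pairing p (λ t → a * f t) ≡ a * pairing p f
pairing-* []            a f = sym (*-zeroʳ a)
pairing-* ((c , t) ∷ p) a f rewrite pairing-* p a f = lemma c a (f t) (pairing p f)
  where
  lemma : ∀ c a x S → c * (a * x) + a * S ≡ a * (c * x + S)
  lemma = solve-∀

pairing-0 : ∀ p → pairing p (λ _ → + 0) ≡ + 0
pairing-0 []            = refl
pairing-0 ((c , t) ∷ p) rewrite pairing-0 p | *-zeroʳ c = refl

pairing-++ : ∀ p q h → pairing (p ++ q) h ≡ pairing p h + pairing q h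
pairing-++ []            q h = sym (+-identityˡ _)
pairing-++ ((c , t) ∷ p) q h rewrite pairing-++ p q h = sym (+-assoc (c * h t) _ _)

pairing-swap : ∀ p q (H : Mon → Mon → ℤ) →
               pairing p (λ t → pairing q (H t)) ≡ pairing q (λ s → pairing p (λ t → H t s))
pairing-swap []            q H = sym (pairing-0 q)
pairing-swap ((c , t) ∷ p) q H = begin
  c * pairing q (H t) + pairing p (λ t′ → pairing q (H t′))
    ≡⟨ cong₂ _+_ (pairing-* q c (H t)) (sym (pairing-swap p q H)) ⟨
  pairing q (λ s → c * H t s) + pairing q (λ s → pairing p (λ t′ → H t′ s))
    ≡⟨ pairing-+ q (λ s → c * H t s) (λ s → pairing p (λ t′ → H t′ s)) ⟨
  pairing q (λ s → c * H t s + pairing p (λ t′ → H t′ s))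
    ∎
  where open ≡-Reasoning

mulTerm : ℤ × Mon → ℤ × Mon → ℤ × Mon
mulTerm (c , t) (d , s) = (c * d , t +M s)

coeff-++ : ∀ p q m → coeff (p ++ q) m ≡ coeff p m + coeff q m
coeff-++ []            q m = sym (+-identityˡ _)
coeff-++ ((c , t) ∷ p) q m rewrite coeff-++ p q m = sym (+-assoc (term c t m) _ _)

coeff-neg : ∀ p m → coeff (-P p) m ≡ - coeff p m
coeff-neg []            m = refl
coeff-neg ((c , t) ∷ p) m = begin
  term (- c) t m + coeff (-P p) m      ≡⟨ cong₂ _+_ (if-neg (t ==M m)) (coeff-neg p m) ⟩
  - term c t m + - coeff p m           ≡⟨ neg-distrib-+ (term c t m) (coeff p m) ⟨
  - (term c t m + coeff p m)           ∎
  where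
  open ≡-Reasoning
  if-neg : ∀ b → (if b then - c else + 0) ≡ - (if b then c else + 0)
  if-neg true  = refl
  if-neg false = refl

coeff-shift : ∀ c t q m → coeff (map (mulTerm (c , t)) q) m ≡ c * coeff q (m -M t)
coeff-shift c t []            m = sym (*-zeroʳ c)
coeff-shift c t ((d , s) ∷ q) m = begin
  (if (t +M s) ==M m then c * d else + 0) + coeff (map (mulTerm (c , t)) q) m
    ≡⟨ cong₂ _+_ (cong (λ b → if b then c * d else + 0) (==M-⇔ (+M≡⇔≡-M t s m)))
                 (coeff-shift c t q m) ⟩
  (if s ==M (m -M t) then c * d else + 0) + c * coeff q (m -M t)
    ≡⟨ cong (_+ c * coeff q (m -M t)) (if-then-0-* (s ==M (m -M t)) c d) ⟩
  c * (if s ==M (m -M t) then d else + 0) + c * coeff q (m -M t)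
    ≡⟨ *-distribˡ-+ c _ _ ⟨
  c * coeff ((d , s) ∷ q) (m -M t)
    ∎
  where open ≡-Reasoning

coeff-*ˡ : ∀ p q m → coeff (p *P q) m ≡ pairing p (λ t → coeff q (m -M t))
coeff-*ˡ []            q m = refl
coeff-*ˡ ((c , t) ∷ p) q m =
  trans (coeff-++ (map (mulTerm (c , t)) q) (p *P q) m)
        (cong₂ _+_ (coeff-shift c t q m) (coeff-*ˡ p q m))

coeff-*ʳ : ∀ p q m → coeff (p *P q) m ≡ pairing q (λ s → coeff p (m -M s))
coeff-*ʳ p q m = begin
  coeff (p *P q) m
    ≡⟨ coeff-*ˡ p q m ⟩
  pairing p (λ t → coeff q (m -M t))
    ≡⟨ pairing-cong p (λ t → coeff-pairing q (m -M t)) ⟩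
  pairing p (λ t → pairing q (indicator (m -M t)))
    ≡⟨ pairing-swap p q (λ t → indicator (m -M t)) ⟩
  pairing q (λ s → pairing p (λ t → indicator (m -M t) s))
    ≡⟨ pairing-cong q (λ s → pairing-cong p (λ t → cong (λ b → if b then + 1 else + 0) (shift-sym s t))) ⟩
  pairing q (λ s → pairing p (indicator (m -M s)))
    ≡⟨ pairing-cong q (λ s → coeff-pairing p (m -M s)) ⟨
  pairing q (λ s → coeff p (m -M s))
    ∎
  where
  open ≡-Reasoning
  shift-sym : ∀ s t → s ==M (m -M t) ≡ t ==M (m -M s)
  shift-sym s t = ==M-⇔ (⇔.trans (⇔.sym (+M≡⇔≡-M t s m))
                               (⇔.trans (mk⇔ (trans (+M-comm s t)) (trans (+M-comm t s)))
                                        (+M≡⇔≡-M s t m)))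

-- The ring of Laurent polynomials

infix 4 _≋_

-- Wrapping the coefficientwise equality in a record makes both sides inferable from a proof.
record _≋_ (p q : Poly) : Set where
  constructor coeffwise
  field coeff-≡ : p ≈P q

open _≋_ public

≡⇒≋ : ∀ {p q} → p ≡ q → p ≋ q
≡⇒≋ refl = coeffwise λ _ → refl

≋-isEquivalence : IsEquivalence _≋_
≋-isEquivalence = record
  { refl  = coeffwise λ _ → refl
  ; sym   = λ p≋q → coeffwise λ m → sym (coeff-≡ p≋q m)
  ; trans = λ p≋q q≋r → coeffwise λ m → trans (coeff-≡ p≋q m) (coeff-≡ q≋r m)
  }

+P-cong : ∀ {p p′ q q′} → p ≋ p′ → q ≋ q′ → p +P q ≋ p′ +P q′
+P-cong {p} {p′} {q} {q′} p≋p′ q≋q′ = coeffwise λ m → begin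
  coeff (p ++ q) m         ≡⟨ coeff-++ p q m ⟩
  coeff p m + coeff q m    ≡⟨ cong₂ _+_ (coeff-≡ p≋p′ m) (coeff-≡ q≋q′ m) ⟩
  coeff p′ m + coeff q′ m  ≡⟨ coeff-++ p′ q′ m ⟨
  coeff (p′ ++ q′) m       ∎
  where open ≡-Reasoning

+P-assoc : ∀ p q r → (p +P q) +P r ≋ p +P (q +P r)
+P-assoc p q r = coeffwise λ m → cong (λ s → coeff s m) (List.++-assoc p q r)

+P-comm : ∀ p q → p +P q ≋ q +P p
+P-comm p q = coeffwise λ m →
  trans (coeff-++ p q m) (trans (+-comm (coeff p m) (coeff q m)) (sym (coeff-++ q p m)))

+P-identityˡ : ∀ p → 0P +P p ≋ p
+P-identityˡ p = coeffwise λ _ → refl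

+P-identityʳ : ∀ p → p +P 0P ≋ p
+P-identityʳ p = coeffwise λ m → cong (λ s → coeff s m) (List.++-identityʳ p)

-P-inverseˡ : ∀ p → (-P p) +P p ≋ 0P
-P-inverseˡ p = coeffwise λ m →
  trans (coeff-++ (-P p) p m) (trans (cong (_+ coeff p m) (coeff-neg p m)) (+-inverseˡ (coeff p m)))

-P-inverseʳ : ∀ p → p +P (-P p) ≋ 0P
-P-inverseʳ p = coeffwise λ m →
  trans (coeff-++ p (-P p) m) (trans (cong (λ x → coeff p m + x) (coeff-neg p m)) (+-inverseʳ (coeff p m)))

-P-cong : ∀ {p q} → p ≋ q → (-P p) ≋ (-P q)
-P-cong {p} {q} p≋q = coeffwise λ m →
  trans (coeff-neg p m) (trans (cong -_ (coeff-≡ p≋q m)) (sym (coeff-neg q m)))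

*P-cong : ∀ {p p′ q q′} → p ≋ p′ → q ≋ q′ → p *P q ≋ p′ *P q′
*P-cong {p} {p′} {q} {q′} p≋p′ q≋q′ = coeffwise λ m → begin
  coeff (p *P q) m                      ≡⟨ coeff-*ˡ p q m ⟩
  pairing p (λ t → coeff q (m -M t))    ≡⟨ pairing-cong p (λ t → coeff-≡ q≋q′ (m -M t)) ⟩
  pairing p (λ t → coeff q′ (m -M t))   ≡⟨ coeff-*ˡ p q′ m ⟨
  coeff (p *P q′) m                     ≡⟨ coeff-*ʳ p q′ m ⟩
  pairing q′ (λ s → coeff p (m -M s))   ≡⟨ pairing-cong q′ (λ s → coeff-≡ p≋p′ (m -M s)) ⟩
  pairing q′ (λ s → coeff p′ (m -M s))  ≡⟨ coeff-*ʳ p′ q′ m ⟨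
  coeff (p′ *P q′) m                    ∎
  where open ≡-Reasoning

*P-comm : ∀ p q → p *P q ≋ q *P p
*P-comm p q = coeffwise λ m → trans (coeff-*ˡ p q m) (sym (coeff-*ʳ q p m))

*P-assoc : ∀ p q r → (p *P q) *P r ≋ p *P (q *P r)
*P-assoc p q r = coeffwise λ m → begin
  coeff ((p *P q) *P r) m
    ≡⟨ coeff-*ʳ (p *P q) r m ⟩
  pairing r (λ s → coeff (p *P q) (m -M s))
    ≡⟨ pairing-cong r (λ s → coeff-*ˡ p q (m -M s)) ⟩
  pairing r (λ s → pairing p (λ t → coeff q ((m -M s) -M t)))
    ≡⟨ pairing-cong r (λ s → pairing-cong p (λ t → cong (coeff q) (-M-swap m s t))) ⟩
  pairing r (λ s → pairing p (λ t → coeff q ((m -M t) -M s)))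
    ≡⟨ pairing-swap p r (λ t s → coeff q ((m -M t) -M s)) ⟨
  pairing p (λ t → pairing r (λ s → coeff q ((m -M t) -M s)))
    ≡⟨ pairing-cong p (λ t → coeff-*ʳ q r (m -M t)) ⟨
  pairing p (λ t → coeff (q *P r) (m -M t))
    ≡⟨ coeff-*ˡ p (q *P r) m ⟨
  coeff (p *P (q *P r)) m
    ∎
  where open ≡-Reasoning

*P-identityˡ : ∀ p → 1P *P p ≋ p
*P-identityˡ p = coeffwise λ m → begin
  coeff (1P *P p) m                    ≡⟨ coeff-*ˡ 1P p m ⟩
  + 1 * coeff p (m -M 0M) + + 0        ≡⟨ +-identityʳ _ ⟩
  + 1 * coeff p (m -M 0M)              ≡⟨ *-identityˡ _ ⟩
  coeff p (m -M 0M)                    ≡⟨ cong (coeff p) (-M-0M m) ⟩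
  coeff p m                            ∎
  where open ≡-Reasoning

*P-identityʳ : ∀ p → p *P 1P ≋ p
*P-identityʳ p = coeffwise λ m → trans (coeff-≡ (*P-comm p 1P) m) (coeff-≡ (*P-identityˡ p) m)

*P-distribˡ : ∀ p q r → p *P (q +P r) ≋ (p *P q) +P (p *P r)
*P-distribˡ p q r = coeffwise λ m → begin
  coeff (p *P (q +P r)) m
    ≡⟨ coeff-*ˡ p (q +P r) m ⟩
  pairing p (λ t → coeff (q ++ r) (m -M t))
    ≡⟨ pairing-cong p (λ t → coeff-++ q r (m -M t)) ⟩
  pairing p (λ t → coeff q (m -M t) + coeff r (m -M t))
    ≡⟨ pairing-+ p (λ t → coeff q (m -M t)) (λ t → coeff r (m -M t)) ⟩
  pairing p (λ t → coeff q (m -M t)) + pairing p (λ t → coeff r (m -M t))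
    ≡⟨ cong₂ _+_ (coeff-*ˡ p q m) (coeff-*ˡ p r m) ⟨
  coeff (p *P q) m + coeff (p *P r) m
    ≡⟨ coeff-++ (p *P q) (p *P r) m ⟨
  coeff ((p *P q) +P (p *P r)) m
    ∎
  where open ≡-Reasoning

*P-distribʳ : ∀ p q r → (q +P r) *P p ≋ (q *P p) +P (r *P p)
*P-distribʳ p q r = coeffwise λ m → begin
  coeff ((q +P r) *P p) m
    ≡⟨ coeff-*ˡ (q +P r) p m ⟩
  pairing (q ++ r) (λ t → coeff p (m -M t))
    ≡⟨ pairing-++ q r (λ t → coeff p (m -M t)) ⟩
  pairing q (λ t → coeff p (m -M t)) + pairing r (λ t → coeff p (m -M t))
    ≡⟨ cong₂ _+_ (coeff-*ˡ q p m) (coeff-*ˡ r p m) ⟨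
  coeff (q *P p) m + coeff (r *P p) m
    ≡⟨ coeff-++ (q *P p) (r *P p) m ⟨
  coeff ((q *P p) +P (r *P p)) m
    ∎
  where open ≡-Reasoning

polyRing : CommutativeRing 0ℓ 0ℓ
polyRing = record
  { Carrier = Poly
  ; _≈_ = _≋_
  ; _+_ = _+P_
  ; _*_ = _*P_
  ; -_ = -P_
  ; 0# = 0P
  ; 1# = 1P
  ; isCommutativeRing = record
    { isRing = record
      { +-isAbelianGroup = record
        { isGroup = record
          { isMonoid = record
            { isSemigroup = record
              { isMagma = record { isEquivalence = ≋-isEquivalence ; ∙-cong = +P-cong }
              ; assoc = +P-assoc
              }
            ; identity = +P-identityˡ , +P-identityʳ
            }
          ; inverse = -P-inverseˡ , -P-inverseʳ
          ; ⁻¹-cong = -P-cong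
          }
        ; comm = +P-comm
        }
      ; *-cong = *P-cong
      ; *-assoc = *P-assoc
      ; *-identity = *P-identityˡ , *P-identityʳ
      ; distrib = *P-distribˡ , *P-distribʳ
      }
    ; *-comm = *P-comm
    }
  }

module PolySolver =
  Tactic.RingSolver.NonReflective (fromCommutativeRing polyRing (λ _ → nothing))

open PolySolver using (solve; _⊜_; _⊕_; _⊗_)
open CommutativeRing polyRing using (ring; +-group; distribʳ)
  renaming (refl to ≋-refl; sym to ≋-sym; trans to ≋-trans)
open import Algebra.Properties.Group +-group using (x∙y⁻¹≈ε⇒x≈y; x≈y⇒x∙y⁻¹≈ε)
open import Algebra.Properties.Ring ring using (-‿distribˡ-*)

module ≋-Reasoning = Relation.Binary.Reasoning.Setoid (CommutativeRing.setoid polyRing)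

*P-congˡ : ∀ a {p q} → p ≋ q → a *P p ≋ a *P q
*P-congˡ a = *P-cong (≋-refl {a})

*P-congʳ : ∀ a {p q} → p ≋ q → p *P a ≋ q *P a
*P-congʳ a p≋q = *P-cong p≋q (≋-refl {a})

*P-swapˡ : ∀ a b c → a *P (b *P c) ≋ b *P (a *P c)
*P-swapˡ = solve 3 (λ a b c → a ⊗ (b ⊗ c) ⊜ b ⊗ (a ⊗ c)) ≋-refl

*P-interchange : ∀ w x y z → (w *P x) *P (y *P z) ≋ (w *P y) *P (x *P z)
*P-interchange = solve 4 (λ w x y z → (w ⊗ x) ⊗ (y ⊗ z) ⊜ (w ⊗ y) ⊗ (x ⊗ z)) ≋-refl

-- Sorted representatives

consTerm : ℤ → Mon → Poly → Poly
consTerm (+ 0) t p = p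
consTerm c     t p = (c , t) ∷ p

coeff-consTerm : ∀ c t p m → coeff (consTerm c t p) m ≡ term c t m + coeff p m
coeff-consTerm (+ 0)      t p m =
  sym (trans (cong (_+ coeff p m) (if-0 (t ==M m))) (+-identityˡ (coeff p m)))
  where
  if-0 : ∀ b → (if b then + 0 else + 0) ≡ + 0
  if-0 true  = refl
  if-0 false = refl
coeff-consTerm (+ suc n)  t p m = refl
coeff-consTerm -[1+ n ]   t p m = refl

_≤M_ : Mon → Mon → Bool
(a , b , c) ≤M (a′ , b′ , c′) =
  if a ==ℤ a′ then (if b ==ℤ b′ then c ℤ.≤ᵇ c′ else b ℤ.≤ᵇ b′) else a ℤ.≤ᵇ a′

-- Correct on all inputs; on lists sorted by _≤M_ equal monomials meet, so that terms cancel.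
merge : Poly → Poly → Poly
merge []            q             = q
merge (x ∷ p)       []            = x ∷ p
merge ((c , t) ∷ p) ((d , s) ∷ q) =
  if t ==M s then consTerm (c + d) t (merge p q)
  else if t ≤M s then (c , t) ∷ merge p ((d , s) ∷ q)
  else (d , s) ∷ merge ((c , t) ∷ p) q

private
  Merges : Poly → Poly → Mon → Set
  Merges p q m = coeff (merge p q) m ≡ coeff p m + coeff q m

  merges-∷ : ∀ c t p d s q m → Merges p q m → Merges p ((d , s) ∷ q) m → Merges ((c , t) ∷ p) q m →
             Merges ((c , t) ∷ p) ((d , s) ∷ q) m
  merges-∷ c t p d s q m ih ihˡ ihʳ with t ==M s in t==s
  ... | true with refl ← ==M-sound t s t==s = begin
    coeff (consTerm (c + d) t (merge p q)) m
      ≡⟨ coeff-consTerm (c + d) t (merge p q) m ⟩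
    term (c + d) t m + coeff (merge p q) m
      ≡⟨ cong₂ _+_ (term-+ (t ==M m)) ih ⟩
    (term c t m + term d t m) + (coeff p m + coeff q m)
      ≡⟨ interchange (term c t m) (term d t m) (coeff p m) (coeff q m) ⟩
    (term c t m + coeff p m) + (term d t m + coeff q m)
      ∎
    where
    open ≡-Reasoning
    term-+ : ∀ b → (if b then c + d else + 0) ≡ (if b then c else + 0) + (if b then d else + 0)
    term-+ true  = refl
    term-+ false = refl
    interchange : ∀ a b c d → (a + b) + (c + d) ≡ (a + c) + (b + d)
    interchange = solve-∀
  ... | false with t ≤M s
  ...   | true  = trans (cong (_+_ (term c t m)) ihˡ) (sym (+-assoc (term c t m) (coeff p m) _))
  ...   | false = trans (cong (_+_ (term d s m)) ihʳ)
                        (rotate (term d s m) (coeff ((c , t) ∷ p) m) (coeff q m))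
    where
    rotate : ∀ a b c → a + (b + c) ≡ b + (a + c)
    rotate = solve-∀

coeff-merge : ∀ p q m → coeff (merge p q) m ≡ coeff p m + coeff q m
coeff-merge []            q             m = sym (+-identityˡ (coeff q m))
coeff-merge (x ∷ p)       []            m = sym (+-identityʳ (coeff (x ∷ p) m))
coeff-merge ((c , t) ∷ p) ((d , s) ∷ q) m =
  merges-∷ c t p d s q m (coeff-merge p q m) (coeff-merge p ((d , s) ∷ q) m) (coeff-merge ((c , t) ∷ p) q m)

merge-≋ : ∀ p q → merge p q ≋ p +P q
merge-≋ p q = coeffwise λ m → trans (coeff-merge p q m) (sym (coeff-++ p q m))

evens odds : Poly → Poly
evens []      = []
evens (x ∷ p) = x ∷ odds p
odds []      = []
odds (x ∷ p) = evens p

coeff-evens+odds : ∀ p m → coeff (evens p) m + coeff (odds p) m ≡ coeff p m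
coeff-evens+odds []            m = refl
coeff-evens+odds ((c , t) ∷ p) m =
  trans (+-assoc (term c t m) (coeff (odds p) m) (coeff (evens p) m))
        (cong (_+_ (term c t m))
              (trans (+-comm (coeff (odds p) m) (coeff (evens p) m)) (coeff-evens+odds p m)))

-- The fuel bounds the recursion depth; it only affects how well the result is sorted.
mergeSort : ℕ → Poly → Poly
mergeSort zero    p           = p
mergeSort (suc n) []          = []
mergeSort (suc n) (x ∷ [])    = x ∷ []
mergeSort (suc n) (x ∷ y ∷ p) = merge (mergeSort n (evens (x ∷ y ∷ p))) (mergeSort n (odds (x ∷ y ∷ p)))

mergeSort-≋ : ∀ n p → mergeSort n p ≋ p
mergeSort-≋ zero    p           = coeffwise λ _ → refl
mergeSort-≋ (suc n) []          = coeffwise λ _ → refl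
mergeSort-≋ (suc n) (x ∷ [])    = coeffwise λ _ → refl
mergeSort-≋ (suc n) (x ∷ y ∷ p) = coeffwise λ m → begin
  coeff (merge (mergeSort n (evens (x ∷ y ∷ p))) (mergeSort n (odds (x ∷ y ∷ p)))) m
    ≡⟨ coeff-merge (mergeSort n (evens (x ∷ y ∷ p))) (mergeSort n (odds (x ∷ y ∷ p))) m ⟩
  coeff (mergeSort n (evens (x ∷ y ∷ p))) m + coeff (mergeSort n (odds (x ∷ y ∷ p))) m
    ≡⟨ cong₂ _+_ (coeff-≡ (mergeSort-≋ n (evens (x ∷ y ∷ p))) m)
                 (coeff-≡ (mergeSort-≋ n (odds (x ∷ y ∷ p))) m) ⟩
  coeff (evens (x ∷ y ∷ p)) m + coeff (odds (x ∷ y ∷ p)) m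
    ≡⟨ coeff-evens+odds (x ∷ y ∷ p) m ⟩
  coeff (x ∷ y ∷ p) m
    ∎
  where open ≡-Reasoning

normalise : Poly → Poly
normalise = mergeSort 40

normalise-≋ : ∀ p → normalise p ≋ p
normalise-≋ = mergeSort-≋ 40

mulSorted : Poly → Poly → Poly
mulSorted []      q = []
mulSorted (x ∷ p) q = merge (map (mulTerm x) q) (mulSorted p q)

mulSorted-≋ : ∀ p q → mulSorted p q ≋ p *P q
mulSorted-≋ []      q = coeffwise λ _ → refl
mulSorted-≋ (x ∷ p) q = coeffwise λ m → begin
  coeff (merge (map (mulTerm x) q) (mulSorted p q)) m
    ≡⟨ coeff-merge (map (mulTerm x) q) (mulSorted p q) m ⟩
  coeff (map (mulTerm x) q) m + coeff (mulSorted p q) m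
    ≡⟨ cong (_+_ (coeff (map (mulTerm x) q) m)) (coeff-≡ (mulSorted-≋ p q) m) ⟩
  coeff (map (mulTerm x) q) m + coeff (p *P q) m
    ≡⟨ coeff-++ (map (mulTerm x) q) (p *P q) m ⟨
  coeff ((x ∷ p) *P q) m
    ∎
  where open ≡-Reasoning

altSign : ℕ → ℤ
altSign zero    = + 1
altSign (suc n) = - altSign n

altSign-oddℕ : ∀ n → (if oddℕ n then - (+ 1) else + 1) ≡ altSign n
altSign-oddℕ zero    = refl
altSign-oddℕ (suc n) with oddℕ n | altSign-oddℕ n
... | true  | eq = cong -_ eq
... | false | eq = cong -_ eq

altSign-+ : ∀ m n → altSign (m ℕ.+ n) ≡ altSign m * altSign n
altSign-+ zero    n = sym (*-identityˡ (altSign n))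
altSign-+ (suc m) n = trans (cong -_ (altSign-+ m n)) (neg-distribˡ-* (altSign m) (altSign n))

altSign-⊖ : ∀ m n → altSign ∣ m ⊖ n ∣ ≡ altSign (m ℕ.+ n)
altSign-⊖ zero    zero    = refl
altSign-⊖ zero    (suc n) = refl
altSign-⊖ (suc m) zero    = cong altSign (sym (ℕₚ.+-identityʳ (suc m)))
altSign-⊖ (suc m) (suc n) = begin
  altSign ∣ suc m ⊖ suc n ∣          ≡⟨ cong (λ i → altSign ∣ i ∣) ([1+m]⊖[1+n]≡m⊖n m n) ⟩
  altSign ∣ m ⊖ n ∣                  ≡⟨ altSign-⊖ m n ⟩
  altSign (m ℕ.+ n)                  ≡⟨ neg-involutive (altSign (m ℕ.+ n)) ⟨
  altSign (suc (suc (m ℕ.+ n)))      ≡⟨ cong (λ k → altSign (suc k)) (ℕₚ.+-suc m n) ⟨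
  altSign (suc m ℕ.+ suc n)          ∎
  where
  open ≡-Reasoning

altSign-∣+∣ : ∀ i j → altSign ∣ i + j ∣ ≡ altSign (∣ i ∣ ℕ.+ ∣ j ∣)
altSign-∣+∣ (+ m)    (+ n)    = refl
altSign-∣+∣ (+ m)    -[1+ n ] = altSign-⊖ m (suc n)
altSign-∣+∣ -[1+ m ] (+ n)    = trans (altSign-⊖ n (suc m)) (cong altSign (ℕₚ.+-comm n (suc m)))
altSign-∣+∣ -[1+ m ] -[1+ n ] = cong (λ k → altSign (suc k)) (sym (ℕₚ.+-suc m n))

signPow-+ : ∀ s i j → signPow s (i + j) ≡ signPow s i * signPow s j
signPow-+ false i j = refl
signPow-+ true  i j = begin
  signPow true (i + j)                ≡⟨ altSign-oddℕ ∣ i + j ∣ ⟩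
  altSign ∣ i + j ∣                   ≡⟨ altSign-∣+∣ i j ⟩
  altSign (∣ i ∣ ℕ.+ ∣ j ∣)           ≡⟨ altSign-+ ∣ i ∣ ∣ j ∣ ⟩
  altSign ∣ i ∣ * altSign ∣ j ∣       ≡⟨ cong₂ _*_ (altSign-oddℕ ∣ i ∣) (altSign-oddℕ ∣ j ∣) ⟨
  signPow true i * signPow true j     ∎
  where open ≡-Reasoning

signPow≢0 : ∀ s e → signPow s e ≢ + 0
signPow≢0 false e ()
signPow≢0 true  e with oddℕ ∣ e ∣
... | true  = λ ()
... | false = λ ()

substMon : Subst → Mon → Mon
substMon ((_ , b₁₁ , b₁₂) , (_ , b₂₁ , b₂₂)) (a , e₁ , e₂) =
  (a , e₁ * b₁₁ + e₂ * b₂₁ , e₁ * b₁₂ + e₂ * b₂₂)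

substSign : Subst → Mon → ℤ
substSign ((s₁ , _) , (s₂ , _)) (_ , e₁ , e₂) = signPow s₁ e₁ * signPow s₂ e₂

substTerm : Subst → ℤ × Mon → ℤ × Mon
substTerm σ (c , t) = (c * substSign σ t , substMon σ t)

substP-map : ∀ σ p → substP σ p ≡ map (substTerm σ) p
substP-map σ p = List.map-cong (λ { (c , t) → cong (_, substMon σ t) (*-assoc c _ _) }) p

substSign≢0 : ∀ σ t → substSign σ t ≢ + 0
substSign≢0 ((s₁ , _) , (s₂ , _)) (_ , e₁ , e₂) eq with i*j≡0⇒i≡0∨j≡0 (signPow s₁ e₁) eq
... | inj₁ eq₁ = signPow≢0 s₁ e₁ eq₁
... | inj₂ eq₂ = signPow≢0 s₂ e₂ eq₂

substSign-0M : ∀ σ → substSign σ 0M ≡ + 1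
substSign-0M ((false , _) , (false , _)) = refl
substSign-0M ((false , _) , (true  , _)) = refl
substSign-0M ((true  , _) , (false , _)) = refl
substSign-0M ((true  , _) , (true  , _)) = refl

substTerm-mulTerm : ∀ σ x y → substTerm σ (mulTerm x y) ≡ mulTerm (substTerm σ x) (substTerm σ y)
substTerm-mulTerm σ@((s₁ , b₁₁ , b₁₂) , (s₂ , b₂₁ , b₂₂)) (c , (a , e₁ , e₂)) (c′ , (a′ , e₁′ , e₂′))
  rewrite signPow-+ s₁ e₁ e₁′ | signPow-+ s₂ e₂ e₂′ =
    cong₂ _,_ (sign c c′ (signPow s₁ e₁) (signPow s₂ e₂) (signPow s₁ e₁′) (signPow s₂ e₂′))
              (cong₂ (λ x y → (a + a′ , x , y))
                     (exponent e₁ e₁′ e₂ e₂′ b₁₁ b₂₁) (exponent e₁ e₁′ e₂ e₂′ b₁₂ b₂₂))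
  where
  sign : ∀ c c′ x y x′ y′ → (c * c′) * ((x * x′) * (y * y′)) ≡ (c * (x * y)) * (c′ * (x′ * y′))
  sign = solve-∀
  exponent : ∀ e e′ f f′ b d → (e + e′) * b + (f + f′) * d ≡ (e * b + f * d) + (e′ * b + f′ * d)
  exponent = solve-∀

substP-* : ∀ σ p q → substP σ (p *P q) ≡ substP σ p *P substP σ q
substP-* σ p q = begin
  substP σ (p *P q)                            ≡⟨ substP-map σ (p *P q) ⟩
  map (substTerm σ) (p *P q)                   ≡⟨ map-substTerm-* p ⟩
  map (substTerm σ) p *P map (substTerm σ) q   ≡⟨ cong₂ _*P_ (substP-map σ p) (substP-map σ q) ⟨
  substP σ p *P substP σ q                     ∎
  where
  open ≡-Reasoning
  map-substTerm-* : ∀ p → map (substTerm σ) (p *P q) ≡ map (substTerm σ) p *P map (substTerm σ) q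
  map-substTerm-* []      = refl
  map-substTerm-* (x ∷ p) = begin
    map (substTerm σ) (map (mulTerm x) q ++ p *P q)
      ≡⟨ List.map-++ (substTerm σ) (map (mulTerm x) q) (p *P q) ⟩
    map (substTerm σ) (map (mulTerm x) q) ++ map (substTerm σ) (p *P q)
      ≡⟨ cong₂ _++_ (trans (sym (List.map-∘ q))
                           (trans (List.map-cong (substTerm-mulTerm σ x) q) (List.map-∘ q)))
                    (map-substTerm-* p) ⟩
    map (mulTerm (substTerm σ x)) (map (substTerm σ) q) ++ (map (substTerm σ) p *P map (substTerm σ) q)
      ∎

substP-1P : ∀ σ → substP σ 1P ≡ 1P
substP-1P σ = trans (substP-map σ 1P) (cong (λ c → (c , 0M) ∷ []) (trans (*-identityˡ _) (substSign-0M σ)))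

Involutive : Subst → Set
Involutive σ = ∀ t → substMon σ (substMon σ t) ≡ t

module _ (σ : Subst) (inv : Involutive σ) where

  coeff-substP : ∀ p m → coeff (substP σ p) m ≡ substSign σ (substMon σ m) * coeff p (substMon σ m)
  coeff-substP p m = trans (cong (λ p → coeff p m) (substP-map σ p)) (coeff-map p)
    where
    open ≡-Reasoning
    m′ : Mon
    m′ = substMon σ m
    moved : ∀ t → substMon σ t ==M m ≡ t ==M m′
    moved t = ==M-⇔ (mk⇔ (λ eq → trans (sym (inv t)) (cong (substMon σ) eq))
                         (λ eq → trans (cong (substMon σ) eq) (inv m)))
    coeff-map : ∀ p → coeff (map (substTerm σ) p) m ≡ substSign σ m′ * coeff p m′
    coeff-map []            = sym (*-zeroʳ (substSign σ m′))
    coeff-map ((c , t) ∷ p) = begin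
      term (c * substSign σ t) (substMon σ t) m + coeff (map (substTerm σ) p) m
        ≡⟨ cong₂ _+_ (cong (λ b → if b then c * substSign σ t else + 0) (moved t)) (coeff-map p) ⟩
      (if t ==M m′ then c * substSign σ t else + 0) + substSign σ m′ * coeff p m′
        ≡⟨ cong (_+ substSign σ m′ * coeff p m′) (head (t ==M m′) refl) ⟩
      substSign σ m′ * term c t m′ + substSign σ m′ * coeff p m′
        ≡⟨ *-distribˡ-+ (substSign σ m′) (term c t m′) (coeff p m′) ⟨
      substSign σ m′ * coeff ((c , t) ∷ p) m′
        ∎
      where
      head : ∀ b → t ==M m′ ≡ b →
             (if b then c * substSign σ t else + 0) ≡ substSign σ m′ * (if b then c else + 0)
      head true  t==m′ rewrite ==M-sound t m′ t==m′ = *-comm c (substSign σ m′)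
      head false _     = sym (*-zeroʳ (substSign σ m′))

  substP-cong : ∀ {p q} → p ≋ q → substP σ p ≋ substP σ q
  substP-cong {p} {q} p≋q = coeffwise λ m → begin
    coeff (substP σ p) m
      ≡⟨ coeff-substP p m ⟩
    substSign σ (substMon σ m) * coeff p (substMon σ m)
      ≡⟨ cong (substSign σ (substMon σ m) *_) (coeff-≡ p≋q (substMon σ m)) ⟩
    substSign σ (substMon σ m) * coeff q (substMon σ m)
      ≡⟨ coeff-substP q m ⟨
    coeff (substP σ q) m
      ∎
    where open ≡-Reasoning

  substMon-0M⇔ : ∀ t → substMon σ t ≡ 0M ⇔ t ≡ 0M
  substMon-0M⇔ t = mk⇔ (λ eq → trans (sym (inv t)) (cong (substMon σ) eq)) (λ { refl → refl })

involutive-sigmaSub : ∀ j → Involutive (sigmaSub j)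
involutive-sigmaSub zero       (a , e₁ , e₂) = cong₂ (λ x y → (a , x , y)) (first e₁ e₂) (second e₁ e₂)
  where
  first : ∀ e₁ e₂ → (e₁ * - (+ 1) + e₂ * + 3) * - (+ 1) + (e₁ * + 0 + e₂ * + 1) * + 3 ≡ e₁
  first = solve-∀
  second : ∀ e₁ e₂ → (e₁ * - (+ 1) + e₂ * + 3) * + 0 + (e₁ * + 0 + e₂ * + 1) * + 1 ≡ e₂
  second = solve-∀
involutive-sigmaSub (suc zero) (a , e₁ , e₂) = cong₂ (λ x y → (a , x , y)) (first e₁ e₂) (second e₁ e₂)
  where
  first : ∀ e₁ e₂ → (e₁ * + 1 + e₂ * + 0) * + 1 + (e₁ * + 1 + e₂ * - (+ 1)) * + 0 ≡ e₁
  first = solve-∀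
  second : ∀ e₁ e₂ → (e₁ * + 1 + e₂ * + 0) * + 1 + (e₁ * + 1 + e₂ * - (+ 1)) * - (+ 1) ≡ e₂
  second = solve-∀

involutive-epsSub : ∀ j → Involutive (epsSub j)
involutive-epsSub j (a , e₁ , e₂) = cong₂ (λ x y → (a , x , y)) (first e₁ e₂) (second e₁ e₂)
  where
  first : ∀ e₁ e₂ → (e₁ * + 1 + e₂ * + 0) * + 1 + (e₁ * + 0 + e₂ * + 1) * + 0 ≡ e₁
  first = solve-∀
  second : ∀ e₁ e₂ → (e₁ * + 1 + e₂ * + 0) * + 0 + (e₁ * + 0 + e₂ * + 1) * + 1 ≡ e₂
  second = solve-∀

-- Denominator factors and cancellation

data Factor : Set where
  binomial : ℤ → Mon → Factor
  monomial : ℤ → Mon → Factor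

⟦_⟧ : Factor → Poly
⟦ binomial c M ⟧ = (+ 1 , 0M) ∷ (- c , M) ∷ []
⟦ monomial c M ⟧ = (c , M) ∷ []

∏ : List Factor → Poly
∏ []       = 1P
∏ (f ∷ fs) = ⟦ f ⟧ *P ∏ fs

_≟F_ : DecidableEquality Factor
binomial c M ≟F binomial d N =
  map′ (λ { (refl , refl) → refl }) (λ { refl → refl , refl }) (c ℤ.≟ d ×-dec M ≟M N)
monomial c M ≟F monomial d N =
  map′ (λ { (refl , refl) → refl }) (λ { refl → refl , refl }) (c ℤ.≟ d ×-dec M ≟M N)
binomial _ _ ≟F monomial _ _ = no λ ()
monomial _ _ ≟F binomial _ _ = no λ ()

∏-++ : ∀ xs ys → ∏ (xs ++ ys) ≋ ∏ xs *P ∏ ys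
∏-++ []       ys = ≋-sym (*P-identityˡ (∏ ys))
∏-++ (x ∷ xs) ys = ≋-trans (*P-congˡ ⟦ x ⟧ (∏-++ xs ys)) (≋-sym (*P-assoc ⟦ x ⟧ (∏ xs) (∏ ys)))

Valid : Factor → Set
Valid (binomial _ M) = M ≢ 0M
Valid (monomial c _) = c ≢ + 0

valid? : Decidable Valid
valid? (binomial _ M) = ¬? (M ≟M 0M)
valid? (monomial c _) = ¬? (c ℤ.≟ + 0)

ZeroDivisorFree : Poly → Set
ZeroDivisorFree d = ∀ p → p *P d ≋ 0P → p ≋ 0P

Cancellable : Poly → Set
Cancellable d = ∀ p q → p *P d ≋ q *P d → p ≋ q

zeroDivisorFree⇒cancellable : ∀ {d} → ZeroDivisorFree d → Cancellable d
zeroDivisorFree⇒cancellable {d} free p q pd≋qd = x∙y⁻¹≈ε⇒x≈y p q (free (p +P (-P q)) (begin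
  (p +P (-P q)) *P d           ≈⟨ distribʳ d p (-P q) ⟩
  (p *P d) +P ((-P q) *P d)    ≈⟨ +P-cong ≋-refl (-‿distribˡ-* q d) ⟨
  (p *P d) +P (-P (q *P d))    ≈⟨ x≈y⇒x∙y⁻¹≈ε pd≋qd ⟩
  0P                           ∎))
  where open ≋-Reasoning

cancellable-1P : Cancellable 1P
cancellable-1P p q p1≋q1 = ≋-trans (≋-sym (*P-identityʳ p)) (≋-trans p1≋q1 (*P-identityʳ q))

cancellable-* : ∀ {a b} → Cancellable a → Cancellable b → Cancellable (a *P b)
cancellable-* {a} {b} canc-a canc-b p q pab≋qab = canc-b p q (canc-a (p *P b) (q *P b) (begin
  (p *P b) *P a     ≈⟨ reassoc p a b ⟩
  p *P (a *P b)     ≈⟨ pab≋qab ⟩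
  q *P (a *P b)     ≈⟨ reassoc q a b ⟨
  (q *P b) *P a     ∎))
  where
  open ≋-Reasoning
  reassoc : ∀ x y z → (x *P z) *P y ≋ x *P (y *P z)
  reassoc = solve 3 (λ x y z → (x ⊗ z) ⊗ y ⊜ x ⊗ (y ⊗ z)) ≋-refl

zeroDivisorFree-monomial : ∀ {c M} → c ≢ + 0 → ZeroDivisorFree ⟦ monomial c M ⟧
zeroDivisorFree-monomial {c} {M} c≢0 p pd≋0 = coeffwise λ m →
  case i*j≡0⇒i≡0∨j≡0 c (c*coeff≡0 m) of λ where
    (inj₁ c≡0)     → ⊥-elim (c≢0 c≡0)
    (inj₂ coeff≡0) → coeff≡0
  where
  open ≡-Reasoning
  c*coeff≡0 : ∀ m → c * coeff p m ≡ + 0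
  c*coeff≡0 m = begin
    c * coeff p m                                ≡⟨ cong (λ t → c * coeff p t) (+M-M m M) ⟨
    c * coeff p ((m +M M) -M M)                  ≡⟨ +-identityʳ _ ⟨
    c * coeff p ((m +M M) -M M) + + 0            ≡⟨ coeff-*ʳ p ⟦ monomial c M ⟧ (m +M M) ⟨
    coeff (p *P ⟦ monomial c M ⟧) (m +M M)       ≡⟨ coeff-≡ pd≋0 (m +M M) ⟩
    + 0                                          ∎

dot : Mon → Mon → ℤ
dot (a , b , c) (a′ , b′ , c′) = a * a′ + b * b′ + c * c′

dot-shift : ∀ M m → dot M (m -M M) ≡ dot M m - dot M M
dot-shift (a , b , c) (a′ , b′ , c′) = expand a b c a′ b′ c′
  where
  expand : ∀ a b c a′ b′ c′ → a * (a′ - a) + b * (b′ - b) + c * (c′ - c) ≡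
                              (a * a′ + b * b′ + c * c′) - (a * a + b * b + c * c)
  expand = solve-∀

square-nonneg : ∀ i → + 0 ≤ i * i
square-nonneg (+ zero)  = +≤+ ℕ.z≤n
square-nonneg (+ suc n) = +≤+ ℕ.z≤n
square-nonneg -[1+ n ] = +≤+ ℕ.z≤n

square-pos : ∀ i → i ≢ + 0 → + 1 ≤ i * i
square-pos (+ zero)  i≢0 = ⊥-elim (i≢0 refl)
square-pos (+ suc n) _   = +≤+ (ℕ.s≤s ℕ.z≤n)
square-pos -[1+ n ]  _   = +≤+ (ℕ.s≤s ℕ.z≤n)

dot-self-pos : ∀ M → M ≢ 0M → + 1 ≤ dot M M
dot-self-pos (a , b , c) M≢0 with a ℤ.≟ + 0 | b ℤ.≟ + 0 | c ℤ.≟ + 0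
... | yes refl | yes refl | yes refl = ⊥-elim (M≢0 refl)
... | no a≢0   | _        | _        =
  +-mono-≤ (+-mono-≤ (square-pos a a≢0) (square-nonneg b)) (square-nonneg c)
... | yes refl | no b≢0   | _        =
  +-mono-≤ (+-mono-≤ (square-nonneg (+ 0)) (square-pos b b≢0)) (square-nonneg c)
... | yes refl | yes refl | no c≢0   =
  +-mono-≤ (+-mono-≤ (square-nonneg (+ 0)) (square-nonneg (+ 0))) (square-pos c c≢0)

lowerBound : (Mon → ℤ) → Poly → ℤ
lowerBound φ []            = + 0
lowerBound φ ((c , t) ∷ p) = φ t ⊓ lowerBound φ p

coeff-below-lowerBound : ∀ φ p m → φ m < lowerBound φ p → coeff p m ≡ + 0
coeff-below-lowerBound φ []            m _ = refl
coeff-below-lowerBound φ ((c , t) ∷ p) m φm<bound = cong₂ _+_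
  (cong (λ b → if b then c else + 0) (==M-false t m t≢m))
  (coeff-below-lowerBound φ p m (<-≤-trans φm<bound (i⊓j≤j (φ t) _)))
  where
  t≢m : t ≢ m
  t≢m refl = <-irrefl refl (<-≤-trans φm<bound (i⊓j≤i (φ t) _))

i≤+∣i∣ : ∀ i → i ≤ + ∣ i ∣
i≤+∣i∣ (+ n)    = ≤-refl
i≤+∣i∣ -[1+ n ] = -≤+

-- Walking from m in the direction -M strictly decreases ⟨M, -⟩, so after finitely many steps
-- one leaves the support of p.
zeroDivisorFree-binomial : ∀ {c M} → M ≢ 0M → ZeroDivisorFree ⟦ binomial c M ⟧
zeroDivisorFree-binomial {c} {M} M≢0 p pd≋0 = coeffwise λ m → vanishes (suc ∣ φ m - L ∣) m (below m)
  where
  φ : Mon → ℤ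
  φ = dot M
  L : ℤ
  L = lowerBound φ p

  recurrence : ∀ m → coeff p m ≡ c * coeff p (m -M M)
  recurrence m = i-j≡0⇒i≡j (coeff p m) (c * coeff p (m -M M)) (begin
    coeff p m - c * coeff p (m -M M)
      ≡⟨ rearrange (coeff p m) c (coeff p (m -M M)) ⟩
    + 1 * coeff p m + (- c * coeff p (m -M M) + + 0)
      ≡⟨ cong (λ t → + 1 * coeff p t + (- c * coeff p (m -M M) + + 0)) (-M-0M m) ⟨
    + 1 * coeff p (m -M 0M) + (- c * coeff p (m -M M) + + 0)
      ≡⟨ coeff-*ʳ p ⟦ binomial c M ⟧ m ⟨
    coeff (p *P ⟦ binomial c M ⟧) m
      ≡⟨ coeff-≡ pd≋0 m ⟩
    + 0
      ∎)
    where
    open ≡-Reasoning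
    rearrange : ∀ x c y → x - c * y ≡ + 1 * x + (- c * y + + 0)
    rearrange = solve-∀

  descend : ∀ k m → φ m < L + + suc k → φ (m -M M) < L + + k
  descend k m φm<L+1+k = begin-strict
    φ (m -M M)          ≡⟨ dot-shift M m ⟩
    φ m - φ M           <⟨ +-monoʳ-< (φ m) (neg-mono-< (suc[i]≤j⇒i<j {+ 0} (dot-self-pos M M≢0))) ⟩
    φ m + + 0           ≡⟨ +-identityʳ (φ m) ⟩
    φ m                 ≤⟨ i<j⇒i≤pred[j] φm<L+1+k ⟩
    ℤ.pred (L + + suc k) ≡⟨ pred-shift L (+ k) ⟩
    L + + k             ∎
    where
    open ≤-Reasoning
    pred-shift : ∀ L K → - (+ 1) + (L + (+ 1 + K)) ≡ L + K
    pred-shift = solve-∀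

  vanishes : ∀ k m → φ m < L + + k → coeff p m ≡ + 0
  vanishes zero    m φm<L   = coeff-below-lowerBound φ p m (subst (φ m <_) (+-identityʳ L) φm<L)
  vanishes (suc k) m φm<L+k = begin
    coeff p m              ≡⟨ recurrence m ⟩
    c * coeff p (m -M M)   ≡⟨ cong (c *_) (vanishes k (m -M M) (descend k m φm<L+k)) ⟩
    c * + 0                ≡⟨ *-zeroʳ c ⟩
    + 0                    ∎
    where open ≡-Reasoning

  below : ∀ m → φ m < L + + suc ∣ φ m - L ∣
  below m = begin-strict
    φ m                   ≡⟨ split (φ m) L ⟩
    L + (φ m - L)         ≤⟨ +-monoʳ-≤ L (i≤+∣i∣ (φ m - L)) ⟩
    L + + ∣ φ m - L ∣     <⟨ +-monoʳ-< L (+<+ (ℕₚ.n<1+n _)) ⟩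
    L + + suc ∣ φ m - L ∣ ∎
    where
    open ≤-Reasoning
    split : ∀ x L → x ≡ L + (x - L)
    split = solve-∀

cancellable-⟦⟧ : ∀ f → Valid f → Cancellable ⟦ f ⟧
cancellable-⟦⟧ (binomial c M) M≢0 = zeroDivisorFree⇒cancellable (zeroDivisorFree-binomial M≢0)
cancellable-⟦⟧ (monomial c M) c≢0 = zeroDivisorFree⇒cancellable (zeroDivisorFree-monomial c≢0)

cancellable-∏ : ∀ {fs} → All Valid fs → Cancellable (∏ fs)
cancellable-∏ []                       = cancellable-1P
cancellable-∏ {f ∷ _} (valid ∷ valids) = cancellable-* (cancellable-⟦⟧ f valid) (cancellable-∏ valids)

nonZero-∏ : ∀ {fs} → All Valid fs → NonZeroP (∏ fs)
nonZero-∏ {fs} valids ∏≈0 = case coeff-≡ (cancellable-∏ valids 1P 0P 1∏≋0∏) 0M of λ ()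
  where
  1∏≋0∏ : 1P *P ∏ fs ≋ 0P *P ∏ fs
  1∏≋0∏ = coeffwise λ m → trans (coeff-≡ (*P-identityˡ (∏ fs)) m) (∏≈0 m)

data Extraction (f : Factor) (gs : List Factor) : Set where
  found  : ∀ rest → ∏ gs ≋ ⟦ f ⟧ *P ∏ rest → Extraction f gs
  absent : Extraction f gs

extract : ∀ f gs → Extraction f gs
extract f []       = absent
extract f (g ∷ gs) with f ≟F g | extract f gs
... | yes refl | _                  = found gs ≋-refl
... | no _     | found rest gs≋f*r  = found (g ∷ rest)
                                        (≋-trans (*P-congˡ ⟦ g ⟧ gs≋f*r) (*P-swapˡ ⟦ g ⟧ ⟦ f ⟧ (∏ rest)))
... | no _     | absent             = absent

record CommonFactors (xs ys : List Factor) : Set where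
  field
    common onlyˡ onlyʳ : List Factor
    splitˡ : ∏ xs ≋ ∏ common *P ∏ onlyˡ
    splitʳ : ∏ ys ≋ ∏ common *P ∏ onlyʳ

-- Recursive results are passed to helpers, here and below, rather than opened in a where block:
-- the evaluator shares function arguments but recomputes a where-bound term at each use.
shareFactor : ∀ {xs ys rest} x → ∏ ys ≋ ⟦ x ⟧ *P ∏ rest →
              CommonFactors xs rest → CommonFactors (x ∷ xs) ys
shareFactor x ys≋x*rest s = record
  { common = x ∷ common ; onlyˡ = onlyˡ ; onlyʳ = onlyʳ
  ; splitˡ = ≋-trans (*P-congˡ ⟦ x ⟧ splitˡ) (≋-sym (*P-assoc ⟦ x ⟧ (∏ common) (∏ onlyˡ)))
  ; splitʳ = ≋-trans ys≋x*rest
              (≋-trans (*P-congˡ ⟦ x ⟧ splitʳ) (≋-sym (*P-assoc ⟦ x ⟧ (∏ common) (∏ onlyʳ))))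
  }
  where open CommonFactors s

keepFactor : ∀ {xs ys} x → CommonFactors xs ys → CommonFactors (x ∷ xs) ys
keepFactor x s = record
  { common = common ; onlyˡ = x ∷ onlyˡ ; onlyʳ = onlyʳ
  ; splitˡ = ≋-trans (*P-congˡ ⟦ x ⟧ splitˡ) (*P-swapˡ ⟦ x ⟧ (∏ common) (∏ onlyˡ))
  ; splitʳ = splitʳ
  }
  where open CommonFactors s

commonFactors : ∀ xs ys → CommonFactors xs ys
commonFactors []       ys = record
  { common = [] ; onlyˡ = [] ; onlyʳ = ys
  ; splitˡ = ≋-sym (*P-identityˡ 1P) ; splitʳ = ≋-sym (*P-identityˡ (∏ ys)) }
commonFactors (x ∷ xs) ys with extract x ys
... | found rest ys≋x*rest = shareFactor x ys≋x*rest (commonFactors xs rest)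
... | absent               = keepFactor x (commonFactors xs ys)

mulFactors : Poly → List Factor → Poly
mulFactors p []       = p
mulFactors p (f ∷ fs) = mulSorted ⟦ f ⟧ (mulFactors p fs)

mulFactors-≋ : ∀ p fs → mulFactors p fs ≋ p *P ∏ fs
mulFactors-≋ p []       = ≋-sym (*P-identityʳ p)
mulFactors-≋ p (f ∷ fs) = begin
  mulSorted ⟦ f ⟧ (mulFactors p fs)   ≈⟨ mulSorted-≋ ⟦ f ⟧ (mulFactors p fs) ⟩
  ⟦ f ⟧ *P mulFactors p fs            ≈⟨ *P-congˡ ⟦ f ⟧ (mulFactors-≋ p fs) ⟩
  ⟦ f ⟧ *P (p *P ∏ fs)                ≈⟨ *P-swapˡ ⟦ f ⟧ p (∏ fs) ⟩
  p *P (⟦ f ⟧ *P ∏ fs)                ∎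
  where open ≋-Reasoning

-- Fractions with factored denominators

-- numer / ∏ denom is the fraction in lowest terms (as far as the factor lists show), while
-- fullDenom factors the denominator that the Frac operations actually build.
record Factored : Set where
  constructor factored
  field
    numer     : Poly
    denom     : List Factor
    fullDenom : List Factor

open Factored public

record Represents (r : Factored) (F : Frac) : Set where
  field
    cross      : num F *P ∏ (denom r) ≋ numer r *P den F
    fullDenom≋ : den F ≋ ∏ (fullDenom r)
    fullValid  : All Valid (fullDenom r)

open Represents public

fromPolyR : Poly → Factored
fromPolyR p = factored (normalise p) [] []

represents-fromP : ∀ p → Represents (fromPolyR p) (fromP p)
represents-fromP p = record
  { cross = *P-congʳ 1P (≋-sym (normalise-≋ p)) ; fullDenom≋ = ≋-refl ; fullValid = [] }

fullDenom-++ : ∀ {F G} a b → Represents a F → Represents b G →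
               den F *P den G ≋ ∏ (fullDenom a ++ fullDenom b)
fullDenom-++ a b Ra Rb =
  ≋-trans (*P-cong (fullDenom≋ Ra) (fullDenom≋ Rb)) (≋-sym (∏-++ (fullDenom a) (fullDenom b)))

_*R_ : Factored → Factored → Factored
a *R b = factored (mulSorted (numer a) (numer b)) (denom a ++ denom b) (fullDenom a ++ fullDenom b)

represents-* : ∀ {a b F G} → Represents a F → Represents b G → Represents (a *R b) (F *F G)
represents-* {a} {b} {nF , dF} {nG , dG} Ra Rb = record
  { cross = begin
      (nF *P nG) *P ∏ (denom a ++ denom b)    ≈⟨ *P-congˡ (nF *P nG) (∏-++ (denom a) (denom b)) ⟩
      (nF *P nG) *P (A *P B)                  ≈⟨ *P-interchange nF nG A B ⟩
      (nF *P A) *P (nG *P B)                  ≈⟨ *P-cong (cross Ra) (cross Rb) ⟩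
      (numer a *P dF) *P (numer b *P dG)      ≈⟨ *P-interchange (numer a) dF (numer b) dG ⟩
      (numer a *P numer b) *P (dF *P dG)      ≈⟨ *P-congʳ (dF *P dG) (mulSorted-≋ (numer a) (numer b)) ⟨
      mulSorted (numer a) (numer b) *P (dF *P dG) ∎
  ; fullDenom≋ = fullDenom-++ a b Ra Rb
  ; fullValid = Allₚ.++⁺ (fullValid Ra) (fullValid Rb)
  }
  where
  open ≋-Reasoning
  A B : Poly
  A = ∏ (denom a)
  B = ∏ (denom b)

-R_ : Factored → Factored
-R a = factored (-P numer a) (denom a) (fullDenom a)

represents-neg : ∀ {a F} → Represents a F → Represents (-R a) (-F F)
represents-neg {a} {nF , dF} Ra = record
  { cross = begin
      (-P nF) *P ∏ (denom a)       ≈⟨ -‿distribˡ-* nF (∏ (denom a)) ⟨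
      -P (nF *P ∏ (denom a))       ≈⟨ -P-cong (cross Ra) ⟩
      -P (numer a *P dF)           ≈⟨ -‿distribˡ-* (numer a) dF ⟩
      (-P numer a) *P dF           ∎
  ; fullDenom≋ = fullDenom≋ Ra
  ; fullValid = fullValid Ra
  }
  where open ≋-Reasoning

addR : ∀ a b → CommonFactors (denom a) (denom b) → Factored
addR a b s = factored (merge (mulFactors (numer a) onlyʳ) (mulFactors (numer b) onlyˡ))
                      (common ++ (onlyˡ ++ onlyʳ))
                      (fullDenom a ++ fullDenom b)
  where open CommonFactors s

_+R_ : Factored → Factored → Factored
a +R b = addR a b (commonFactors (denom a) (denom b))

represents-+ : ∀ {a b F G} → Represents a F → Represents b G → Represents (a +R b) (F +F G)
represents-+ {a} {b} {nF , dF} {nG , dG} Ra Rb = record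
  { cross = begin
      ((nF *P dG) +P (nG *P dF)) *P ∏ (common ++ (onlyˡ ++ onlyʳ))
        ≈⟨ *P-congˡ ((nF *P dG) +P (nG *P dF)) denom≋ ⟩
      ((nF *P dG) +P (nG *P dF)) *P (g *P (r₁ *P r₂))
        ≈⟨ spread nF dF nG dG g r₁ r₂ ⟩
      ((nF *P (g *P r₁)) *P (dG *P r₂)) +P ((nG *P (g *P r₂)) *P (dF *P r₁))
        ≈⟨ +P-cong (*P-congʳ (dG *P r₂) (*P-congˡ nF (≋-sym splitˡ)))
                   (*P-congʳ (dF *P r₁) (*P-congˡ nG (≋-sym splitʳ))) ⟩
      ((nF *P ∏ (denom a)) *P (dG *P r₂)) +P ((nG *P ∏ (denom b)) *P (dF *P r₁))
        ≈⟨ +P-cong (*P-congʳ (dG *P r₂) (cross Ra)) (*P-congʳ (dF *P r₁) (cross Rb)) ⟩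
      ((numer a *P dF) *P (dG *P r₂)) +P ((numer b *P dG) *P (dF *P r₁))
        ≈⟨ collect (numer a) dF (numer b) dG r₁ r₂ ⟩
      ((numer a *P r₂) +P (numer b *P r₁)) *P (dF *P dG)
        ≈⟨ *P-congʳ (dF *P dG) numer≋ ⟨
      merge (mulFactors (numer a) onlyʳ) (mulFactors (numer b) onlyˡ) *P (dF *P dG)
        ∎
  ; fullDenom≋ = fullDenom-++ a b Ra Rb
  ; fullValid = Allₚ.++⁺ (fullValid Ra) (fullValid Rb)
  }
  where
  open ≋-Reasoning
  open CommonFactors (commonFactors (denom a) (denom b))
  g r₁ r₂ : Poly
  g  = ∏ common
  r₁ = ∏ onlyˡ
  r₂ = ∏ onlyʳ
  denom≋ : ∏ (common ++ (onlyˡ ++ onlyʳ)) ≋ g *P (r₁ *P r₂)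
  denom≋ = ≋-trans (∏-++ common (onlyˡ ++ onlyʳ)) (*P-congˡ g (∏-++ onlyˡ onlyʳ))
  numer≋ : merge (mulFactors (numer a) onlyʳ) (mulFactors (numer b) onlyˡ) ≋
           (numer a *P r₂) +P (numer b *P r₁)
  numer≋ = ≋-trans (merge-≋ (mulFactors (numer a) onlyʳ) (mulFactors (numer b) onlyˡ))
                   (+P-cong (mulFactors-≋ (numer a) onlyʳ) (mulFactors-≋ (numer b) onlyˡ))
  spread : ∀ nF dF nG dG g r₁ r₂ →
           ((nF *P dG) +P (nG *P dF)) *P (g *P (r₁ *P r₂)) ≋
           ((nF *P (g *P r₁)) *P (dG *P r₂)) +P ((nG *P (g *P r₂)) *P (dF *P r₁))
  spread = solve 7 (λ nF dF nG dG g r₁ r₂ →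
    ((nF ⊗ dG) ⊕ (nG ⊗ dF)) ⊗ (g ⊗ (r₁ ⊗ r₂)) ⊜
    (((nF ⊗ (g ⊗ r₁)) ⊗ (dG ⊗ r₂)) ⊕ ((nG ⊗ (g ⊗ r₂)) ⊗ (dF ⊗ r₁)))) ≋-refl
  collect : ∀ nA dF nB dG r₁ r₂ →
            ((nA *P dF) *P (dG *P r₂)) +P ((nB *P dG) *P (dF *P r₁)) ≋
            ((nA *P r₂) +P (nB *P r₁)) *P (dF *P dG)
  collect = solve 6 (λ nA dF nB dG r₁ r₂ →
    (((nA ⊗ dF) ⊗ (dG ⊗ r₂)) ⊕ ((nB ⊗ dG) ⊗ (dF ⊗ r₁))) ⊜
    ((nA ⊗ r₂) ⊕ (nB ⊗ r₁)) ⊗ (dF ⊗ dG)) ≋-refl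

_/R_ : Factored → List Factor → Factored
a /R qs = factored (numer a) (denom a ++ qs) (fullDenom a ++ qs)

represents-/ : ∀ {a F q qs} → Represents a F → q ≋ ∏ qs → All Valid qs →
               Represents (a /R qs) (F /F fromP q)
represents-/ {a} {nF , dF} {q} {qs} Ra q≋ valid = record
  { cross = begin
      (nF *P 1P) *P ∏ (denom a ++ qs)        ≈⟨ *P-cong (*P-identityʳ nF) (∏-++ (denom a) qs) ⟩
      nF *P (∏ (denom a) *P ∏ qs)            ≈⟨ *P-assoc nF (∏ (denom a)) (∏ qs) ⟨
      (nF *P ∏ (denom a)) *P ∏ qs            ≈⟨ *P-cong (cross Ra) (≋-sym q≋) ⟩
      (numer a *P dF) *P q                   ≈⟨ *P-assoc (numer a) dF q ⟩
      numer a *P (dF *P q)                   ∎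
  ; fullDenom≋ = ≋-trans (*P-cong (fullDenom≋ Ra) q≋) (≋-sym (∏-++ (fullDenom a) qs))
  ; fullValid = Allₚ.++⁺ (fullValid Ra) valid
  }
  where open ≋-Reasoning

halfR : Factored
halfR = factored 1P (monomial (+ 2) 0M ∷ []) (monomial (+ 2) 0M ∷ [])

represents-half : Represents halfR halfF
represents-half = record
  { cross = *P-congˡ 1P (*P-identityʳ (mon (+ 2) (+ 0) (+ 0) (+ 0)))
  ; fullDenom≋ = ≋-sym (*P-identityʳ (mon (+ 2) (+ 0) (+ 0) (+ 0)))
  ; fullValid = (λ ()) ∷ []
  }

substFactor : Subst → Factor → Factor
substFactor σ (binomial c M) = binomial (c * substSign σ M) (substMon σ M)
substFactor σ (monomial c M) = monomial (c * substSign σ M) (substMon σ M)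

substP-⟦⟧ : ∀ σ f → substP σ ⟦ f ⟧ ≡ ⟦ substFactor σ f ⟧
substP-⟦⟧ σ (binomial c M) = trans (substP-map σ ⟦ binomial c M ⟧)
  (cong₂ (λ a b → (a , 0M) ∷ (b , substMon σ M) ∷ [])
         (trans (*-identityˡ _) (substSign-0M σ)) (sym (neg-distribˡ-* c (substSign σ M))))
substP-⟦⟧ σ (monomial c M) = substP-map σ ⟦ monomial c M ⟧

substP-∏ : ∀ σ fs → substP σ (∏ fs) ≡ ∏ (map (substFactor σ) fs)
substP-∏ σ []       = substP-1P σ
substP-∏ σ (f ∷ fs) = trans (substP-* σ ⟦ f ⟧ (∏ fs)) (cong₂ _*P_ (substP-⟦⟧ σ f) (substP-∏ σ fs))

valid-substFactor : ∀ {σ} → Involutive σ → ∀ f → Valid f → Valid (substFactor σ f)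
valid-substFactor {σ} inv (binomial c M) M≢0 = M≢0 ∘ Equivalence.to (substMon-0M⇔ σ inv M)
valid-substFactor {σ} inv (monomial c M) c≢0 c*s≡0 with i*j≡0⇒i≡0∨j≡0 c c*s≡0
... | inj₁ c≡0 = c≢0 c≡0
... | inj₂ s≡0 = substSign≢0 σ M s≡0

substR : Subst → Factored → Factored
substR σ a = factored (normalise (substP σ (numer a)))
                      (map (substFactor σ) (denom a))
                      (map (substFactor σ) (fullDenom a))

represents-subst : ∀ {σ a F} → Involutive σ → Represents a F → Represents (substR σ a) (substF σ F)
represents-subst {σ} {a} {nF , dF} inv Ra = record
  { cross = begin
      S nF *P ∏ (map (substFactor σ) (denom a))   ≡⟨ cong (S nF *P_) (substP-∏ σ (denom a)) ⟨
      S nF *P S (∏ (denom a))                     ≡⟨ substP-* σ nF (∏ (denom a)) ⟨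
      S (nF *P ∏ (denom a))                       ≈⟨ substP-cong σ inv (cross Ra) ⟩
      S (numer a *P dF)                           ≡⟨ substP-* σ (numer a) dF ⟩
      S (numer a) *P S dF                         ≈⟨ *P-congʳ (S dF) (normalise-≋ (S (numer a))) ⟨
      normalise (S (numer a)) *P S dF             ∎
  ; fullDenom≋ = ≋-trans (substP-cong σ inv (fullDenom≋ Ra)) (≡⇒≋ (substP-∏ σ (fullDenom a)))
  ; fullValid = Allₚ.map⁺ (All.map (valid-substFactor inv _) (fullValid Ra))
  }
  where
  open ≋-Reasoning
  S : Poly → Poly
  S = substP σ

represents-nonZero : ∀ {a F} → Represents a F → NonZeroP (den F)
represents-nonZero Ra den≈0 =
  nonZero-∏ (fullValid Ra) (λ m → trans (sym (coeff-≡ (fullDenom≋ Ra) m)) (den≈0 m))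

crossCheckWith : ∀ a b → CommonFactors (denom a) (denom b) → Bool
crossCheckWith a b s = null (merge (mulFactors (numer a) onlyʳ) (-P mulFactors (numer b) onlyˡ))
  where open CommonFactors s

crossCheck : Factored → Factored → Bool
crossCheck a b = crossCheckWith a b (commonFactors (denom a) (denom b))

null-merge-neg : ∀ p q → T (null (merge p (-P q))) → p ≋ q
null-merge-neg p q isNull =
  x∙y⁻¹≈ε⇒x≈y p q (≋-trans (≋-sym (merge-≋ p (-P q))) (nil≋0 (merge p (-P q)) isNull))
  where
  nil≋0 : ∀ r → T (null r) → r ≋ 0P
  nil≋0 [] _ = ≋-refl

crossCheck-sound : ∀ a b → T (crossCheck a b) → numer a *P ∏ (denom b) ≋ numer b *P ∏ (denom a)
crossCheck-sound a b check = begin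
  numer a *P ∏ (denom b)           ≈⟨ *P-congˡ (numer a) splitʳ ⟩
  numer a *P (g *P r₂)             ≈⟨ *P-swapˡ (numer a) g r₂ ⟩
  g *P (numer a *P r₂)             ≈⟨ *P-congˡ g reduced ⟩
  g *P (numer b *P r₁)             ≈⟨ *P-swapˡ g (numer b) r₁ ⟩
  numer b *P (g *P r₁)             ≈⟨ *P-congˡ (numer b) splitˡ ⟨
  numer b *P ∏ (denom a)           ∎
  where
  open ≋-Reasoning
  open CommonFactors (commonFactors (denom a) (denom b))
  g r₁ r₂ : Poly
  g  = ∏ common
  r₁ = ∏ onlyˡ
  r₂ = ∏ onlyʳ
  reduced : numer a *P r₂ ≋ numer b *P r₁
  reduced = ≋-trans (≋-sym (mulFactors-≋ (numer a) onlyʳ))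
                    (≋-trans (null-merge-neg _ _ check) (mulFactors-≋ (numer b) onlyˡ))

represents-≈F : ∀ {a b F G} → Represents a F → Represents b G →
                All Valid (denom a) → All Valid (denom b) → T (crossCheck a b) → F ≈F G
represents-≈F {a} {b} {nF , dF} {nG , dG} Ra Rb valid-a valid-b check =
  coeff-≡ (cancellable-* (cancellable-∏ valid-a) (cancellable-∏ valid-b) (nF *P dG) (nG *P dF) (begin
    (nF *P dG) *P (A *P B)        ≈⟨ *P-interchange nF dG A B ⟩
    (nF *P A) *P (dG *P B)        ≈⟨ *P-congʳ (dG *P B) (cross Ra) ⟩
    (numer a *P dF) *P (dG *P B)  ≈⟨ regroup (numer a) dF dG B ⟩
    (numer a *P B) *P (dF *P dG)  ≈⟨ *P-congʳ (dF *P dG) (crossCheck-sound a b check) ⟩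
    (numer b *P A) *P (dF *P dG)  ≈⟨ *P-congˡ (numer b *P A) (*P-comm dF dG) ⟩
    (numer b *P A) *P (dG *P dF)  ≈⟨ regroup (numer b) dG dF A ⟨
    (numer b *P dG) *P (dF *P A)  ≈⟨ *P-congʳ (dF *P A) (cross Rb) ⟨
    (nG *P B) *P (dF *P A)        ≈⟨ *P-interchange nG dF B A ⟨
    (nG *P dF) *P (B *P A)        ≈⟨ *P-congˡ (nG *P dF) (*P-comm B A) ⟩
    (nG *P dF) *P (A *P B)        ∎))
  where
  open ≋-Reasoning
  A B : Poly
  A = ∏ (denom a)
  B = ∏ (denom b)
  regroup : ∀ n d d′ e → (n *P d) *P (d′ *P e) ≋ (n *P e) *P (d *P d′)
  regroup = solve 4 (λ n d d′ e → (n ⊗ d) ⊗ (d′ ⊗ e) ⊜ (n ⊗ e) ⊗ (d ⊗ d′)) ≋-refl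

-- The G₂ computation

uBinomial : Fin 2 → Factor
uBinomial zero       = binomial (+ 1) (+ 1 , + 1 , + 0)
uBinomial (suc zero) = binomial (+ 1) (+ 1 , + 0 , + 1)

uBinomial-∏ : ∀ j → 1P +P (-P (uP *P xpow j (+ 1))) ≋ ∏ (uBinomial j ∷ [])
uBinomial-∏ zero       = ≡⇒≋ refl
uBinomial-∏ (suc zero) = ≡⇒≋ refl

uBinomial-valid : ∀ j → All Valid (uBinomial j ∷ [])
uBinomial-valid zero       = (λ ()) ∷ []
uBinomial-valid (suc zero) = (λ ()) ∷ []

-- f | σ_j computed from A = f(σ_j x) and B = f(ε_j σ_j x).
reflectR : Fin 2 → Factored → Factored → Factored
reflectR j A B =
  fromPolyR (-P xpow j (+ 2)) *R
    ( ((fromPolyR (1P +P (-P (uP *P xpow j (- (+ 1))))) /R (uBinomial j ∷ [])) *R (halfR *R (A +R B)))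
      +R (fromPolyR (xpow j (- (+ 1))) *R (halfR *R (A +R (-R B)))) )

actR : Factored → Fin 2 → Factored
actR a j = reflectR j (substR (sigmaSub j) a) (substR (sigmaSub j) (substR (epsSub j) a))

represents-∣σ : ∀ {a F} j → Represents a F → Represents (actR a j) (F ∣σ j)
represents-∣σ {a} {F} j Ra =
  represents-* (represents-fromP (-P xpow j (+ 2)))
    (represents-+
      (represents-* (represents-/ {qs = uBinomial j ∷ []}
                                  (represents-fromP (1P +P (-P (uP *P xpow j (- (+ 1))))))
                                  (uBinomial-∏ j) (uBinomial-valid j))
                    (represents-* represents-half (represents-+ RA RB)))
      (represents-* (represents-fromP (xpow j (- (+ 1))))
                    (represents-* represents-half (represents-+ RA (represents-neg RB)))))
  where
  RA : Represents (substR (sigmaSub j) a) (substF (sigmaSub j) F)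
  RA = represents-subst (involutive-sigmaSub j) Ra
  RB : Represents (substR (sigmaSub j) (substR (epsSub j) a)) (substF (sigmaSub j) (substF (epsSub j) F))
  RB = represents-subst (involutive-sigmaSub j) (represents-subst (involutive-epsSub j) Ra)

represents-∣ : ∀ {a F} w → Represents a F → Represents (foldl actR a w) (F ∣ w)
represents-∣ []      Ra = Ra
represents-∣ (j ∷ w) Ra = represents-∣ w (represents-∣σ j Ra)

sumR : List Factored → Factored
sumR = foldr _+R_ (fromPolyR 0P)

represents-sum : ∀ {A : Set} {f : A → Factored} {F : A → Frac} →
                 (∀ x → Represents (f x) (F x)) → ∀ xs → Represents (sumR (map f xs)) (sumF (map F xs))
represents-sum R []       = represents-fromP 0P
represents-sum R (x ∷ xs) = represents-+ (R x) (represents-sum R xs)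

oneMinusX2-factor : ℤ × ℤ → Factor
oneMinusX2-factor (n₁ , n₂) = binomial (+ 1) (+ 0 , + 2 * n₁ , + 2 * n₂)

orbitSumR : Factored → List (List (Fin 2)) → Factored
orbitSumR a ws = sumR (map (foldl actR a) ws)

represents-orbitSum : ∀ {a F} → Represents a F → ∀ ws → Represents (orbitSumR a ws) (sumF (map (_∣_ F) ws))
represents-orbitSum {a} {F} Ra = represents-sum {f = foldl actR a} {F = _∣_ F} (λ w → represents-∣ w Ra)

represents-1F : Represents (fromPolyR 1P) 1F
represents-1F = represents-fromP 1P

posRoots-∏ : foldr (λ α → _*P_ (oneMinusX2 α)) 1P posRootsG2 ≋ ∏ (map oneMinusX2-factor posRootsG2)
posRoots-∏ = ≡⇒≋ refl

ZR : Factored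
ZR = orbitSumR (fromPolyR 1P) WeylG2 /R map oneMinusX2-factor posRootsG2

-- Here and below the implicit arguments are given explicitly, in the η-contracted form in which
-- the definitions of Defs are stored: otherwise the conversion checker evaluates the huge
-- unreduced fractions.
represents-Z : Represents ZR ZG2
represents-Z =
  represents-/ {a = orbitSumR (fromPolyR 1P) WeylG2} {F = sumF (map (_∣_ 1F) WeylG2)}
               {q = foldr (λ α → _*P_ (oneMinusX2 α)) 1P posRootsG2}
               {qs = map oneMinusX2-factor posRootsG2}
               (represents-orbitSum represents-1F WeylG2) posRoots-∏
               ((λ ()) ∷ (λ ()) ∷ (λ ()) ∷ (λ ()) ∷ (λ ()) ∷ (λ ()) ∷ [])

lhsR : Factored
lhsR = ZR *R fromPolyR (1P +P (-P (mon (+ 1) (+ 2) (+ 2 ℤ.* proj₁ θℓ) (+ 2 ℤ.* proj₂ θℓ))))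

represents-lhs : Represents lhsR lhsG2
represents-lhs =
  represents-*
    {a = ZR} {b = fromPolyR (1P +P (-P (mon (+ 1) (+ 2) (+ 2 ℤ.* proj₁ θℓ) (+ 2 ℤ.* proj₂ θℓ))))}
    {F = ZG2} {G = fromP (1P +P (-P (mon (+ 1) (+ 2) (+ 2 ℤ.* proj₁ θℓ) (+ 2 ℤ.* proj₂ θℓ))))}
    represents-Z
    (represents-fromP (1P +P (-P (mon (+ 1) (+ 2) (+ 2 ℤ.* proj₁ θℓ) (+ 2 ℤ.* proj₂ θℓ)))))

gR : Factored
gR = fromPolyR 1P /R (uBinomial s₂ ∷ binomial (+ 1) (+ 1 , + 2 , + 1) ∷ [])

represents-g : Represents gR gG2
represents-g =
  represents-/ {a = fromPolyR 1P} {F = 1F}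
               {q = (1P +P (-P (uP *P xpow s₂ (+ 1)))) *P (1P +P (-P (uP *P xroot (proj₁ θs) (proj₂ θs))))}
               {qs = uBinomial s₂ ∷ binomial (+ 1) (+ 1 , + 2 , + 1) ∷ []}
               represents-1F (≡⇒≋ refl) ((λ ()) ∷ (λ ()) ∷ [])

rhsR : Factored
rhsR = orbitSumR gR ([] ∷ (s₁ ∷ []) ∷ []) /R (binomial (+ 1) (+ 0 , + 2 , + 0) ∷ [])

represents-rhs : Represents rhsR rhsG2
represents-rhs =
  represents-/ {a = orbitSumR gR ([] ∷ (s₁ ∷ []) ∷ [])} {F = sumF (map (_∣_ gG2) ([] ∷ (s₁ ∷ []) ∷ []))}
               {q = 1P +P (-P xpow s₁ (+ 2))} {qs = binomial (+ 1) (+ 0 , + 2 , + 0) ∷ []}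
               (represents-orbitSum represents-g ([] ∷ (s₁ ∷ []) ∷ [])) (≡⇒≋ refl) ((λ ()) ∷ [])

mainTheorem6 : NonZeroP (den lhsG2) × NonZeroP (den rhsG2) × (lhsG2 ≈F rhsG2)
mainTheorem6 =
    represents-nonZero {F = lhsG2} represents-lhs
  , represents-nonZero {F = rhsG2} represents-rhs
  , represents-≈F {a = lhsR} {b = rhsR} {F = lhsG2} {G = rhsG2} represents-lhs represents-rhs
                  (toWitness {a? = All.all? valid? (denom lhsR)} tt)
                  (toWitness {a? = All.all? valid? (denom rhsR)} tt)
                  tt
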